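{- Let $G=(V,E)$ be a connected chordal graph and let $\mathbb{Q}=\{Q_1,\ldots,Q_\ell\}$ be the set of maximal cliques of $G$. For $1\le i\le\ell$, let $Simp(Q_i)$ be the set of simplicial vertices of $G$ belonging to $Q_i$. If $|Simp(Q_i)|\ge 2$ for some $i$, then $|Q_i|$ is an eigenvalue of the Laplacian matrix $L(G)$ with multiplicity at least $|Simp(Q_i)|-1$.
   Context: All graphs are finite, simple and undirected. A graph is chordal if every cycle of length at least $4$ has a chord. A vertex is simplicial if its neighbourhood is a clique (set of pairwise adjacent vertices). The Laplacian matrix is $L(G)=D(G)-A(G)$, where $D(G)$ is the diagonal matrix of degrees and $A(G)$ the adjacency matrix. -}

module Defs where

open import Data.Nat using (ℕ; zero; suc; _≤_; _∸_)
open import Data.Bool using (Bool; true; false; if_then_else_)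
open import Data.Fin using (Fin; toℕ; _≟_)
open import Data.Fin.Subset using (Subset; _∈_; _⊆_)
open import Data.List using (List; []; _∷_; foldr; map; allFin)
open import Data.Integer using (ℤ; +_)
open import Data.Rational using (ℚ; _/_; 0ℚ; _+_; _*_; -_)
open import Data.Product using (Σ; ∃; _×_; _,_)
open import Data.Sum using (_⊎_)
open import Relation.Binary.PropositionalEquality using (_≡_; _≢_)
open import Relation.Nullary using (¬_; yes; no)
open import Function.Definitions using (Injective)

record Graph (n : ℕ) : Set where
  field
    adj    : Fin n → Fin n → Bool
    sym    : ∀ u v → adj u v ≡ adj v u
    irrefl : ∀ v → adj v v ≡ false
open Graph public

Adj : ∀ {n} → Graph n → Fin n → Fin n → Set
Adj G u v = adj G u v ≡ true

data Walk {n} (G : Graph n) : Fin n → Fin n → Set where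
  here : ∀ {u} → Walk G u u
  step : ∀ {u v w} → Adj G u v → Walk G v w → Walk G u w

Connected : ∀ {n} → Graph n → Set
Connected G = ∀ u v → Walk G u v

CycNext : (k : ℕ) → Fin k → Fin k → Set
CycNext k i j = (toℕ j ≡ suc (toℕ i)) ⊎ ((toℕ i ≡ k ∸ 1) × (toℕ j ≡ 0))

record Cycle {n} (G : Graph n) (k : ℕ) : Set where
  field
    vert     : Fin k → Fin n
    distinct : Injective _≡_ _≡_ vert
    edges    : ∀ i j → CycNext k i j → Adj G (vert i) (vert j)
open Cycle public

HasChord : ∀ {n} {G : Graph n} {k} → Cycle G k → Set
HasChord {G = G} {k} C =
  Σ _ λ i → Σ _ λ j → Adj G (vert C i) (vert C j) × ¬ CycNext k i j × ¬ CycNext k j i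

Chordal : ∀ {n} → Graph n → Set
Chordal G = ∀ k → 4 ≤ k → (C : Cycle G k) → HasChord C

IsClique : ∀ {n} → Graph n → Subset n → Set
IsClique G Q = ∀ u v → u ∈ Q → v ∈ Q → u ≢ v → Adj G u v

IsMaximalClique : ∀ {n} → Graph n → Subset n → Set
IsMaximalClique G Q = IsClique G Q × (∀ Q′ → IsClique G Q′ → Q ⊆ Q′ → Q′ ⊆ Q)

Simplicial : ∀ {n} → Graph n → Fin n → Set
Simplicial G v = ∀ u w → Adj G v u → Adj G v w → u ≢ w → Adj G u w

sumℕ : ∀ {n} → (Fin n → ℕ) → ℕ
sumℕ {n} f = foldr Data.Nat._+_ 0 (map f (allFin n))

sumℚ : ∀ {n} → (Fin n → ℚ) → ℚ
sumℚ {n} f = foldr _+_ 0ℚ (map f (allFin n))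

ℕ→ℚ : ℕ → ℚ
ℕ→ℚ k = + k / 1

degree : ∀ {n} → Graph n → Fin n → ℕ
degree G v = sumℕ (λ u → if adj G v u then 1 else 0)

laplacian : ∀ {n} → Graph n → Fin n → Fin n → ℚ
laplacian G i j with i ≟ j
... | yes _ = ℕ→ℚ (degree G i)
... | no  _ = if adj G i j then - ℕ→ℚ 1 else 0ℚ

mulVec : ∀ {n} → (Fin n → Fin n → ℚ) → (Fin n → ℚ) → Fin n → ℚ
mulVec M x i = sumℚ (λ j → M i j * x j)

LinIndep : ∀ {n m} → (Fin m → Fin n → ℚ) → Set
LinIndep {n} {m} vs =
  ∀ (c : Fin m → ℚ) → (∀ i → sumℚ (λ j → c j * vs j i) ≡ 0ℚ) → ∀ j → c j ≡ 0ℚ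

-- λ is an eigenvalue of M with (geometric) multiplicity at least m:
-- there are m linearly independent eigenvectors for λ.
EigenvalueMultAtLeast : ∀ {n} → (Fin n → Fin n → ℚ) → ℚ → ℕ → Set
EigenvalueMultAtLeast {n} M λ′ m =
  Σ (Fin m → Fin n → ℚ) λ vs →
    (∀ j i → mulVec M (vs j) i ≡ λ′ * vs j i) × LinIndep vs

-- A simplicial vertex v of the maximal clique Q has a clique as closed neighbourhood,
-- and that clique contains Q, so it is Q: deg v = ∣Q∣ - 1, and u ≠ v is adjacent to v
-- exactly when u ∈ Q. Hence for simplicial a ≠ b in Q the Laplacian columns of a and b
-- agree outside {a, b} while L a a - L a b = ∣Q∣, which makes e_a - e_b an eigenvector
-- for ∣Q∣. Fixing one simplicial a, the vectors e_a - e_s for the other simplicial s of Q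
-- are linearly independent, since e_a - e_s is the only one not vanishing at s.
module Submission where

open import Defs hiding (sym)
open import Data.Nat using (ℕ; _≤_; _∸_)
open import Data.Fin using (Fin)
open import Data.Fin.Subset using (Subset; _∈_; ∣_∣)
open import Data.Product using (_×_)
open import Function.Bundles using (_⇔_)

import Data.Nat as Nat
import Data.Nat.Properties as Nat
import Data.Nat.Coprimality as Coprime
import Data.Integer as ℤ
import Data.Integer.Properties as ℤ
open import Data.Bool using (Bool; true; false; if_then_else_; _∨_)
open import Data.Fin using (zero; suc; _≟_)
open import Data.Fin.Properties using (suc-injective)
open import Data.Fin.Subset using (_⊆_)
open import Data.Fin.Subset.Properties using (⊆-antisym)
import Data.List as List
open import Data.List using (foldr; map; allFin)
open import Data.List.Properties using (map-tabulate; map-cong)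
open import Data.Product using (_,_; proj₁; proj₂)
open import Data.Rational using (ℚ; mkℚ; 0ℚ; 1ℚ; _+_; _*_; -_; _-_; _/_)
open import Data.Rational.Properties
  using (normalize-coprime; neg-injective; neg-distribʳ-*; +-identityˡ; +-identityʳ;
         +-inverseʳ; +-comm; *-identityʳ; *-zeroʳ; +-0-abelianGroup)
open import Algebra.Properties.AbelianGroup +-0-abelianGroup using (⁻¹-anti-homo‿-)
open import Data.Sum using (_⊎_; inj₁; inj₂)
open import Data.Vec using (_∷_; lookup; tabulate; here; there)
open import Data.Vec.Properties using ([]=⇒lookup; lookup⇒[]=; lookup∘tabulate)
open import Function using (_∘_; id)
open import Function.Bundles using (Equivalence)
open import Function.Definitions using (Injective)
open import Relation.Nullary using (does; yes; no; contradiction)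
open import Relation.Nullary.Decidable using (dec-true; dec-false)
open import Relation.Binary.PropositionalEquality
  using (_≡_; _≢_; refl; sym; trans; cong; cong₂; module ≡-Reasoning)
open ≡-Reasoning

indicator : Bool → ℕ
indicator b = if b then 1 else 0

map-allFin-suc : ∀ {A : Set} {n} (f : Fin (Nat.suc n) → A) →
                 map f (allFin (Nat.suc n)) ≡ f zero List.∷ map (f ∘ suc) (allFin n)
map-allFin-suc f = cong (f zero List.∷_)
  (trans (map-tabulate suc f) (sym (map-tabulate id (f ∘ suc))))

sumℕ-suc : ∀ {n} (f : Fin (Nat.suc n) → ℕ) → sumℕ f ≡ f zero Nat.+ sumℕ (f ∘ suc)
sumℕ-suc f = cong (foldr Nat._+_ 0) (map-allFin-suc f)

sumℕ-cong : ∀ {n} {f g : Fin n → ℕ} → (∀ u → f u ≡ g u) → sumℕ f ≡ sumℕ g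
sumℕ-cong {n} f≗g = cong (foldr Nat._+_ 0) (map-cong f≗g (allFin n))

sumℕ-increment : ∀ {n} (f g : Fin n → ℕ) v →
                 (∀ u → u ≢ v → g u ≡ f u) → g v ≡ Nat.suc (f v) →
                 sumℕ g ≡ Nat.suc (sumℕ f)
sumℕ-increment {Nat.suc n} f g zero g≡f gv = begin
  sumℕ g                                ≡⟨ sumℕ-suc g ⟩
  g zero Nat.+ sumℕ (g ∘ suc)           ≡⟨ cong₂ Nat._+_ gv (sumℕ-cong (λ u → g≡f (suc u) λ ())) ⟩
  Nat.suc (f zero Nat.+ sumℕ (f ∘ suc)) ≡⟨ cong Nat.suc (sumℕ-suc f) ⟨
  Nat.suc (sumℕ f)                      ∎
sumℕ-increment {Nat.suc n} f g (suc v) g≡f gv = begin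
  sumℕ g                                 ≡⟨ sumℕ-suc g ⟩
  g zero Nat.+ sumℕ (g ∘ suc)            ≡⟨ cong₂ Nat._+_ (g≡f zero λ ())
                                              (sumℕ-increment (f ∘ suc) (g ∘ suc) v
                                                (λ u u≢v → g≡f (suc u) (u≢v ∘ suc-injective)) gv) ⟩
  f zero Nat.+ Nat.suc (sumℕ (f ∘ suc))  ≡⟨ Nat.+-suc (f zero) _ ⟩
  Nat.suc (f zero Nat.+ sumℕ (f ∘ suc))  ≡⟨ cong Nat.suc (sumℕ-suc f) ⟨
  Nat.suc (sumℕ f)                       ∎

∣x∷p∣≡indicator+∣p∣ : ∀ {n} x (p : Subset n) → ∣ x ∷ p ∣ ≡ indicator x Nat.+ ∣ p ∣
∣x∷p∣≡indicator+∣p∣ true  p = refl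
∣x∷p∣≡indicator+∣p∣ false p = refl

∣tabulate∣≡sumℕ : ∀ {n} (p : Fin n → Bool) → ∣ tabulate p ∣ ≡ sumℕ (indicator ∘ p)
∣tabulate∣≡sumℕ {Nat.zero}  p = refl
∣tabulate∣≡sumℕ {Nat.suc n} p = begin
  ∣ tabulate p ∣                                      ≡⟨ ∣x∷p∣≡indicator+∣p∣ (p zero) (tabulate (p ∘ suc)) ⟩
  indicator (p zero) Nat.+ ∣ tabulate (p ∘ suc) ∣     ≡⟨ cong (indicator (p zero) Nat.+_) (∣tabulate∣≡sumℕ (p ∘ suc)) ⟩
  indicator (p zero) Nat.+ sumℕ (indicator ∘ p ∘ suc) ≡⟨ sumℕ-suc (indicator ∘ p) ⟨
  sumℕ (indicator ∘ p)                                ∎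

sumℚ-suc : ∀ {n} (f : Fin (Nat.suc n) → ℚ) → sumℚ f ≡ f zero + sumℚ (f ∘ suc)
sumℚ-suc f = cong (foldr _+_ 0ℚ) (map-allFin-suc f)

sumℚ-zero : ∀ {n} (f : Fin n → ℚ) → (∀ j → f j ≡ 0ℚ) → sumℚ f ≡ 0ℚ
sumℚ-zero {Nat.zero}  f f≡0 = refl
sumℚ-zero {Nat.suc n} f f≡0 = trans (sumℚ-suc f) (cong₂ _+_ (f≡0 zero) (sumℚ-zero (f ∘ suc) (f≡0 ∘ suc)))

sumℚ-single : ∀ {n} (f : Fin n → ℚ) a → (∀ j → j ≢ a → f j ≡ 0ℚ) → sumℚ f ≡ f a
sumℚ-single f zero f≡0 = begin
  sumℚ f                  ≡⟨ sumℚ-suc f ⟩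
  f zero + sumℚ (f ∘ suc) ≡⟨ cong (f zero +_) (sumℚ-zero (f ∘ suc) (λ j → f≡0 (suc j) λ ())) ⟩
  f zero + 0ℚ             ≡⟨ +-identityʳ (f zero) ⟩
  f zero                  ∎
sumℚ-single f (suc a) f≡0 = begin
  sumℚ f                  ≡⟨ sumℚ-suc f ⟩
  f zero + sumℚ (f ∘ suc) ≡⟨ cong₂ _+_ (f≡0 zero λ ())
                               (sumℚ-single (f ∘ suc) a (λ j j≢a → f≡0 (suc j) (j≢a ∘ suc-injective))) ⟩
  0ℚ + f (suc a)          ≡⟨ +-identityˡ (f (suc a)) ⟩
  f (suc a)               ∎

sumℚ-pair : ∀ {n} (f : Fin n → ℚ) a b → a ≢ b →
            (∀ j → j ≢ a → j ≢ b → f j ≡ 0ℚ) → sumℚ f ≡ f a + f b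
sumℚ-pair f zero    zero    a≢b f≡0 = contradiction refl a≢b
sumℚ-pair f zero    (suc b) a≢b f≡0 = trans (sumℚ-suc f) (cong (f zero +_)
  (sumℚ-single (f ∘ suc) b (λ j j≢b → f≡0 (suc j) (λ ()) (j≢b ∘ suc-injective))))
sumℚ-pair f (suc a) zero    a≢b f≡0 = trans
  (sumℚ-pair f zero (suc a) (a≢b ∘ sym) (λ j j≢0 j≢a → f≡0 j j≢a j≢0))
  (+-comm (f zero) (f (suc a)))
sumℚ-pair f (suc a) (suc b) a≢b f≡0 = begin
  sumℚ f                          ≡⟨ sumℚ-suc f ⟩
  f zero + sumℚ (f ∘ suc)         ≡⟨ cong₂ _+_ (f≡0 zero (λ ()) (λ ()))
                                       (sumℚ-pair (f ∘ suc) a b (a≢b ∘ cong suc)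
                                         (λ j j≢a j≢b → f≡0 (suc j) (j≢a ∘ suc-injective) (j≢b ∘ suc-injective))) ⟩
  0ℚ + (f (suc a) + f (suc b))    ≡⟨ +-identityˡ _ ⟩
  f (suc a) + f (suc b)           ∎

ℕ→ℚ-suc : ∀ k → ℕ→ℚ (Nat.suc k) ≡ ℕ→ℚ k + 1ℚ
ℕ→ℚ-suc k = begin
  ℤ.+ Nat.suc k / 1                  ≡⟨ cong (λ m → ℤ.+ m / 1) (Nat.+-comm 1 k) ⟩
  ℤ.+ (k Nat.+ 1) / 1                ≡⟨ cong (λ z → (z ℤ.+ ℤ.+ 1) / 1) (ℤ.*-identityʳ (ℤ.+ k)) ⟨
  mkℚ (ℤ.+ k) 0 k⊥1 + 1ℚ             ≡⟨ cong (_+ 1ℚ) (normalize-coprime k⊥1) ⟨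
  ℕ→ℚ k + 1ℚ                         ∎
  where k⊥1 = Coprime.sym (Coprime.1-coprimeTo k)

x*-1≡-x : ∀ x → x * - 1ℚ ≡ - x
x*-1≡-x x = trans (sym (neg-distribʳ-* x 1ℚ)) (cong -_ (*-identityʳ x))

basis : ∀ {n} → Fin n → Fin n → ℚ
basis a i = if does (a ≟ i) then 1ℚ else 0ℚ

basis-same : ∀ {n} (a : Fin n) → basis a a ≡ 1ℚ
basis-same a = cong (if_then 1ℚ else 0ℚ) (dec-true (a ≟ a) refl)

basis-other : ∀ {n} {a i : Fin n} → a ≢ i → basis a i ≡ 0ℚ
basis-other {a = a} {i} a≢i = cong (if_then 1ℚ else 0ℚ) (dec-false (a ≟ i) a≢i)

basisDiff : ∀ {n} → Fin n → Fin n → Fin n → ℚ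
basisDiff a b i = basis a i - basis b i

basisDiff-left : ∀ {n} {a b : Fin n} → a ≢ b → basisDiff a b a ≡ 1ℚ
basisDiff-left {a = a} a≢b = cong₂ _-_ (basis-same a) (basis-other (a≢b ∘ sym))

basisDiff-right : ∀ {n} {a b : Fin n} → a ≢ b → basisDiff a b b ≡ - 1ℚ
basisDiff-right {b = b} a≢b = cong₂ _-_ (basis-other a≢b) (basis-same b)

basisDiff-elsewhere : ∀ {n} {a b i : Fin n} → i ≢ a → i ≢ b → basisDiff a b i ≡ 0ℚ
basisDiff-elsewhere i≢a i≢b = cong₂ _-_ (basis-other (i≢a ∘ sym)) (basis-other (i≢b ∘ sym))

mulVec-basisDiff : ∀ {n} (M : Fin n → Fin n → ℚ) {a b} → a ≢ b →
                   ∀ i → mulVec M (basisDiff a b) i ≡ M i a - M i b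
mulVec-basisDiff M {a} {b} a≢b i = begin
  sumℚ (λ j → M i j * basisDiff a b j)             ≡⟨ sumℚ-pair _ a b a≢b vanish ⟩
  M i a * basisDiff a b a + M i b * basisDiff a b b ≡⟨ cong₂ _+_
                                                        (trans (cong (M i a *_) (basisDiff-left a≢b)) (*-identityʳ (M i a)))
                                                        (trans (cong (M i b *_) (basisDiff-right a≢b)) (x*-1≡-x (M i b))) ⟩
  M i a - M i b                                     ∎
  where
  vanish : ∀ j → j ≢ a → j ≢ b → M i j * basisDiff a b j ≡ 0ℚ
  vanish j j≢a j≢b = trans (cong (M i j *_) (basisDiff-elsewhere j≢a j≢b)) (*-zeroʳ (M i j))

basisDiff-eigenvector : ∀ {n} (M : Fin n → Fin n → ℚ) {μ a b} → a ≢ b →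
                        (∀ i → i ≢ a → i ≢ b → M i a ≡ M i b) →
                        M a a - M a b ≡ μ → M b b - M b a ≡ μ →
                        ∀ i → mulVec M (basisDiff a b) i ≡ μ * basisDiff a b i
basisDiff-eigenvector M {μ} {a} {b} a≢b columns gapᵃ gapᵇ i
  with mulVec-basisDiff M a≢b i | i ≟ a | i ≟ b
... | Mv≡ | yes refl | _ = begin
  mulVec M (basisDiff a b) a ≡⟨ trans Mv≡ gapᵃ ⟩
  μ                          ≡⟨ *-identityʳ μ ⟨
  μ * 1ℚ                     ≡⟨ cong (μ *_) (basisDiff-left a≢b) ⟨
  μ * basisDiff a b a        ∎
... | Mv≡ | no _ | yes refl = begin
  mulVec M (basisDiff a b) b ≡⟨ Mv≡ ⟩
  M b a - M b b              ≡⟨ ⁻¹-anti-homo‿- (M b b) (M b a) ⟨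
  - (M b b - M b a)          ≡⟨ cong -_ gapᵇ ⟩
  - μ                        ≡⟨ x*-1≡-x μ ⟨
  μ * - 1ℚ                   ≡⟨ cong (μ *_) (basisDiff-right a≢b) ⟨
  μ * basisDiff a b b        ∎
... | Mv≡ | no i≢a | no i≢b = begin
  mulVec M (basisDiff a b) i ≡⟨ Mv≡ ⟩
  M i a - M i b              ≡⟨ cong (_- M i b) (columns i i≢a i≢b) ⟩
  M i b - M i b              ≡⟨ +-inverseʳ (M i b) ⟩
  0ℚ                         ≡⟨ *-zeroʳ μ ⟨
  μ * 0ℚ                     ≡⟨ cong (μ *_) (basisDiff-elsewhere i≢a i≢b) ⟨
  μ * basisDiff a b i        ∎

basisDiffs-linIndep : ∀ {n m} (a : Fin n) (t : Fin m → Fin n) → Injective _≡_ _≡_ t →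
                      (∀ j → t j ≢ a) → LinIndep (λ j → basisDiff a (t j))
basisDiffs-linIndep a t t-inj t≢a c combination≡0 k = neg-injective (begin
  - c k                                       ≡⟨ x*-1≡-x (c k) ⟨
  c k * - 1ℚ                                  ≡⟨ cong (c k *_) (basisDiff-right (t≢a k ∘ sym)) ⟨
  c k * basisDiff a (t k) (t k)               ≡⟨ sumℚ-single _ k vanish ⟨
  sumℚ (λ j → c j * basisDiff a (t j) (t k))  ≡⟨ combination≡0 (t k) ⟩
  0ℚ                                          ∎)
  where
  vanish : ∀ j → j ≢ k → c j * basisDiff a (t j) (t k) ≡ 0ℚ
  vanish j j≢k = trans (cong (c j *_) (basisDiff-elsewhere (t≢a k) (j≢k ∘ t-inj ∘ sym))) (*-zeroʳ (c j))

∈-tabulate⁺ : ∀ {n} {p : Fin n → Bool} {u} → p u ≡ true → u ∈ tabulate p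
∈-tabulate⁺ {p = p} {u} pu = lookup⇒[]= u (tabulate p) (trans (lookup∘tabulate p u) pu)

∈-tabulate⁻ : ∀ {n} {p : Fin n → Bool} {u} → u ∈ tabulate p → p u ≡ true
∈-tabulate⁻ {p = p} {u} u∈p = trans (sym (lookup∘tabulate p u)) ([]=⇒lookup u∈p)

closedNeighbourhood : ∀ {n} → Graph n → Fin n → Subset n
closedNeighbourhood G v = tabulate (λ u → does (u ≟ v) ∨ adj G v u)

module _ {n} (G : Graph n) where

  ∈-closedNeighbourhood⁺ : ∀ {v u} → u ≡ v ⊎ Adj G v u → u ∈ closedNeighbourhood G v
  ∈-closedNeighbourhood⁺ {v} {u} u~v = ∈-tabulate⁺ (member u~v)
    where
    member : u ≡ v ⊎ Adj G v u → does (u ≟ v) ∨ adj G v u ≡ true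
    member u~v with u ≟ v
    ... | yes _ = refl
    member (inj₁ u≡v) | no u≢v = contradiction u≡v u≢v
    member (inj₂ vu)  | no _   = vu

  ∈-closedNeighbourhood⁻ : ∀ {v u} → u ∈ closedNeighbourhood G v → u ≡ v ⊎ Adj G v u
  ∈-closedNeighbourhood⁻ {v} {u} u∈N = member (∈-tabulate⁻ u∈N)
    where
    member : does (u ≟ v) ∨ adj G v u ≡ true → u ≡ v ⊎ Adj G v u
    member _ with u ≟ v
    member _  | yes u≡v = inj₁ u≡v
    member vu | no _    = inj₂ vu

  ∣closedNeighbourhood∣ : ∀ v → ∣ closedNeighbourhood G v ∣ ≡ Nat.suc (degree G v)
  ∣closedNeighbourhood∣ v = trans (∣tabulate∣≡sumℕ (λ u → does (u ≟ v) ∨ adj G v u))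
                                 (sumℕ-increment (indicator ∘ adj G v) _ v others self)
    where
    others : ∀ u → u ≢ v → indicator (does (u ≟ v) ∨ adj G v u) ≡ indicator (adj G v u)
    others u u≢v = cong (λ b → indicator (b ∨ adj G v u)) (dec-false (u ≟ v) u≢v)
    self : indicator (does (v ≟ v) ∨ adj G v v) ≡ Nat.suc (indicator (adj G v v))
    self = trans (cong (λ b → indicator (b ∨ adj G v v)) (dec-true (v ≟ v) refl))
                 (cong (Nat.suc ∘ indicator) (sym (irrefl G v)))

  simplicial⇒closedNeighbourhood-clique : ∀ {v} → Simplicial G v → IsClique G (closedNeighbourhood G v)
  simplicial⇒closedNeighbourhood-clique {v} v-simp u w u∈N w∈N u≢w
    with ∈-closedNeighbourhood⁻ u∈N | ∈-closedNeighbourhood⁻ w∈N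
  ... | inj₁ refl | inj₁ refl = contradiction refl u≢w
  ... | inj₁ refl | inj₂ vw   = vw
  ... | inj₂ vu   | inj₁ refl = trans (Graph.sym G u v) vu
  ... | inj₂ vu   | inj₂ vw   = v-simp u w vu vw u≢w

  clique⊆closedNeighbourhood : ∀ {Q v} → IsClique G Q → v ∈ Q → Q ⊆ closedNeighbourhood G v
  clique⊆closedNeighbourhood {v = v} Q-clique v∈Q {u} u∈Q with u ≟ v
  ... | yes u≡v = ∈-closedNeighbourhood⁺ (inj₁ u≡v)
  ... | no  u≢v = ∈-closedNeighbourhood⁺ (inj₂ (Q-clique v u v∈Q u∈Q (u≢v ∘ sym)))

laplacian-diag : ∀ {n} (G : Graph n) i → laplacian G i i ≡ ℕ→ℚ (degree G i)
laplacian-diag G i with i ≟ i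
... | yes _   = refl
... | no  i≢i = contradiction refl i≢i

laplacian-offdiag : ∀ {n} (G : Graph n) {i j} → i ≢ j →
                    laplacian G i j ≡ (if adj G i j then - ℕ→ℚ 1 else 0ℚ)
laplacian-offdiag G {i} {j} i≢j with i ≟ j
... | yes i≡j = contradiction i≡j i≢j
... | no  _   = refl

module _ {n} {G : Graph n} {Q : Subset n} (Q-max : IsMaximalClique G Q) where

  closedNeighbourhood≡maximalClique : ∀ {v} → v ∈ Q → Simplicial G v → closedNeighbourhood G v ≡ Q
  closedNeighbourhood≡maximalClique v∈Q v-simp =
    ⊆-antisym (proj₂ Q-max _ (simplicial⇒closedNeighbourhood-clique G v-simp) Q⊆N) Q⊆N
    where Q⊆N = clique⊆closedNeighbourhood G (proj₁ Q-max) v∈Q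

  simplicial-degree : ∀ {v} → v ∈ Q × Simplicial G v → Nat.suc (degree G v) ≡ ∣ Q ∣
  simplicial-degree {v} (v∈Q , v-simp) =
    trans (sym (∣closedNeighbourhood∣ G v)) (cong ∣_∣ (closedNeighbourhood≡maximalClique v∈Q v-simp))

  simplicial-adj : ∀ {v} → v ∈ Q × Simplicial G v → ∀ {u} → u ≢ v → adj G u v ≡ lookup Q u
  simplicial-adj {v} (v∈Q , v-simp) {u} u≢v = begin
    adj G u v                          ≡⟨ Graph.sym G u v ⟩
    adj G v u                          ≡⟨ cong (_∨ adj G v u) (dec-false (u ≟ v) u≢v) ⟨
    does (u ≟ v) ∨ adj G v u           ≡⟨ lookup∘tabulate (λ w → does (w ≟ v) ∨ adj G v w) u ⟨
    lookup (closedNeighbourhood G v) u ≡⟨ cong (λ p → lookup p u) (closedNeighbourhood≡maximalClique v∈Q v-simp) ⟩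
    lookup Q u                         ∎

  laplacian-simplicial-column : ∀ {v} → v ∈ Q × Simplicial G v → ∀ {i} → i ≢ v →
                                laplacian G i v ≡ (if lookup Q i then - ℕ→ℚ 1 else 0ℚ)
  laplacian-simplicial-column v-simp i≢v =
    trans (laplacian-offdiag G i≢v) (cong (if_then - ℕ→ℚ 1 else 0ℚ) (simplicial-adj v-simp i≢v))

  laplacian-simplicial-gap : ∀ {a b} → a ∈ Q × Simplicial G a → b ∈ Q × Simplicial G b → a ≢ b →
                             laplacian G a a - laplacian G a b ≡ ℕ→ℚ ∣ Q ∣
  laplacian-simplicial-gap {a} {b} a-simp b-simp a≢b = begin
    laplacian G a a - laplacian G a b ≡⟨ cong₂ _-_ (laplacian-diag G a)
                                           (trans (laplacian-simplicial-column b-simp a≢b)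
                                                  (cong (if_then - ℕ→ℚ 1 else 0ℚ) ([]=⇒lookup (proj₁ a-simp)))) ⟩
    ℕ→ℚ (degree G a) + 1ℚ             ≡⟨ ℕ→ℚ-suc (degree G a) ⟨
    ℕ→ℚ (Nat.suc (degree G a))        ≡⟨ cong ℕ→ℚ (simplicial-degree a-simp) ⟩
    ℕ→ℚ ∣ Q ∣                         ∎

  laplacian-simplicial-eigenvector : ∀ {a b} → a ∈ Q × Simplicial G a → b ∈ Q × Simplicial G b → a ≢ b →
                                     ∀ i → mulVec (laplacian G) (basisDiff a b) i ≡ ℕ→ℚ ∣ Q ∣ * basisDiff a b i
  laplacian-simplicial-eigenvector a-simp b-simp a≢b =
    basisDiff-eigenvector (laplacian G) a≢b
      (λ i i≢a i≢b → trans (laplacian-simplicial-column a-simp i≢a) (sym (laplacian-simplicial-column b-simp i≢b)))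
      (laplacian-simplicial-gap a-simp b-simp a≢b)
      (laplacian-simplicial-gap b-simp a-simp (a≢b ∘ sym))

  simplicial-vertices⇒eigenvalue : ∀ m (e : Fin m → Fin n) → Injective _≡_ _≡_ e →
                                   (∀ j → e j ∈ Q × Simplicial G (e j)) →
                                   EigenvalueMultAtLeast (laplacian G) (ℕ→ℚ ∣ Q ∣) (m ∸ 1)
  simplicial-vertices⇒eigenvalue Nat.zero    e e-inj e-simp = (λ ()) , (λ ()) , (λ _ _ ())
  simplicial-vertices⇒eigenvalue (Nat.suc m) e e-inj e-simp =
    (λ j → basisDiff (e zero) (e (suc j))) ,
    (λ j → laplacian-simplicial-eigenvector (e-simp zero) (e-simp (suc j)) (e-suc≢e0 j ∘ sym)) ,
    basisDiffs-linIndep (e zero) (e ∘ suc) (suc-injective ∘ e-inj) e-suc≢e0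
    where
    e-suc≢e0 : ∀ j → e (suc j) ≢ e zero
    e-suc≢e0 j eq with e-inj eq
    ... | ()

enumerate : ∀ {n} (p : Subset n) → Fin ∣ p ∣ → Fin n
enumerate (true  ∷ p) zero    = zero
enumerate (true  ∷ p) (suc j) = suc (enumerate p j)
enumerate (false ∷ p) j       = suc (enumerate p j)

enumerate-∈ : ∀ {n} (p : Subset n) j → enumerate p j ∈ p
enumerate-∈ (true  ∷ p) zero    = here
enumerate-∈ (true  ∷ p) (suc j) = there (enumerate-∈ p j)
enumerate-∈ (false ∷ p) j       = there (enumerate-∈ p j)

enumerate-injective : ∀ {n} (p : Subset n) → Injective _≡_ _≡_ (enumerate p)
enumerate-injective (true  ∷ p) {zero}  {zero}  _  = refl
enumerate-injective (true  ∷ p) {suc j} {suc k} eq = cong suc (enumerate-injective p (suc-injective eq))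
enumerate-injective (false ∷ p)                 eq = enumerate-injective p (suc-injective eq)

theorem10 : ∀ {n} (G : Graph n) → Connected G → Chordal G →
            (Q : Subset n) → IsMaximalClique G Q →
            (S : Subset n) → (∀ v → v ∈ S ⇔ (v ∈ Q × Simplicial G v)) →
            2 ≤ ∣ S ∣ →
            EigenvalueMultAtLeast (laplacian G) (ℕ→ℚ ∣ Q ∣) (∣ S ∣ ∸ 1)
theorem10 G _ _ Q Q-max S S≡simplicial-of-Q _ =
  simplicial-vertices⇒eigenvalue Q-max ∣ S ∣ (enumerate S) (enumerate-injective S)
    (λ j → Equivalence.to (S≡simplicial-of-Q _) (enumerate-∈ S j))
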